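{- Let $(Q',\mathbf{z}')$ and $(Q'',\mathbf{z}'')$ be labeled CAT(0) planar graphs with $\mathbf{z}'=(z_1',\dots,z_n')$ and $\mathbf{z}''=(z_1'',\dots,z_n'')$. Suppose $v'\in V(Q')$ satisfies $z_i'=v'$ for all $i$ in a cyclic interval $[p,q]\subset[n]$, and $v''\in V(Q'')$ satisfies $z_i''=v''$ for all $i$ in a cyclic interval $[r,s]\subset[n]$, where both cyclic intervals are proper and $[p,q]\cup[r,s]=[n]$. Let $Q$ be obtained from $Q'$ and $Q''$ by identifying $v'$ with $v''$, with labels $z_i=z_i'$ for $i\in[r,s]$ and $z_i=z_i''$ for $i\in[p,q]$. Then $\pi_\bullet(Q)=\pi_\bullet(Q')+\pi_\bullet(Q'')$.
   Context: A CAT(0) planar graph is a nonempty finite connected directed plane graph whose bounded faces are cyclically oriented triangles, whose interior vertices have degree at least $6$, and in which every vertex and edge lies on a triangular face; labeled means equipped with $\mathbf{z}\in V(Q)^n$. Directed distance $\delta$: minimum walk cost with forward edges costing $1$, backward edges $2$ (computed in the respective graph). For $I\in\binom{[n]}{3}$, $\pi_I(Q)=-\frac13\min_{x\in V(Q)}\sum_{i\in I}\delta(x,z_i)$. A cyclic interval is a set $\{a,a+1,\dots,b\}$ with indices mod $n$. -}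

module Defs where

open import Data.Nat as ℕ using (ℕ; zero; suc; _+_; _≤_; _<_; _⊓_; _≤ᵇ_; _<ᵇ_)
open import Data.Integer using (+_)
open import Data.Rational as ℚ using (ℚ)
open import Data.Fin as Fin using (Fin; toℕ; _↑ˡ_; _↑ʳ_; splitAt; punchOut)
open import Data.Fin.Properties using () renaming (_≟_ to _≟F_)
open import Data.Bool using (Bool; true; false; if_then_else_; _∧_; _∨_; not; T)
open import Data.Bool.Properties using () renaming (_≟_ to _≟B_)
open import Data.List using (List; []; _∷_; upTo; concatMap; map; length; filter; foldr)
open import Data.List.Base using (allFin)
open import Data.Product using (Σ; ∃; ∃-syntax; _×_; _,_; proj₁; proj₂)
open import Data.Product.Properties using (≡-dec)
open import Data.Sum using (_⊎_; inj₁; inj₂; [_,_])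
open import Relation.Nullary using (¬_; Dec; yes; no; does)
open import Relation.Nullary.Decidable using (_×-dec_; _⊎-dec_)
open import Relation.Binary.PropositionalEquality using (_≡_; _≢_; refl; sym)

record Digraph : Set where
  field
    nV  : ℕ
    nE  : ℕ
    src : Fin nE → Fin nV
    tgt : Fin nE → Fin nV
open Digraph public

Vtx : Digraph → Set
Vtx G = Fin (nV G)

data Walk (G : Digraph) : Vtx G → Vtx G → Set where
  []  : ∀ {x} → Walk G x x
  fwd : ∀ {y} (e : Fin (nE G)) → Walk G (tgt G e) y → Walk G (src G e) y
  bwd : ∀ {y} (e : Fin (nE G)) → Walk G (src G e) y → Walk G (tgt G e) y

cost : ∀ {G x y} → Walk G x y → ℕ
cost []        = 0
cost (fwd e w) = 1 + cost w
cost (bwd e w) = 2 + cost w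

IsDirDist : (G : Digraph) → (Vtx G → Vtx G → ℕ) → Set
IsDirDist G d = ∀ x y →
  (Σ (Walk G x y) λ w → cost w ≡ d x y) × (∀ (w : Walk G x y) → d x y ≤ cost w)

Connected : Digraph → Set
Connected G = ∀ x y → Walk G x y

-- Combinatorial embedding in the plane (rotation system).
-- A dart is an edge with a chosen end: (e , true) is the end at src e,
-- (e , false) the end at tgt e.

Dart : Digraph → Set
Dart G = Fin (nE G) × Bool

_≟D_ : ∀ {G} (a b : Dart G) → Dec (a ≡ b)
_≟D_ = ≡-dec _≟F_ _≟B_

dvert : (G : Digraph) → Dart G → Vtx G
dvert G (e , true)  = src G e
dvert G (e , false) = tgt G e

α : ∀ {G} → Dart G → Dart G
α (e , b) = (e , not b)

anyᵇ : ∀ {A : Set} → (A → Bool) → List A → Bool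
anyᵇ p = foldr (λ a b → p a ∨ b) false

allᵇ : ∀ {A : Set} → (A → Bool) → List A → Bool
allᵇ p = foldr (λ a b → p a ∧ b) true

iter : ∀ {A : Set} → ℕ → (A → A) → A → A
iter zero    f a = a
iter (suc k) f a = f (iter k f a)

allDarts : (G : Digraph) → List (Dart G)
allDarts G = concatMap (λ e → (e , true) ∷ (e , false) ∷ []) (allFin (nE G))

nDarts : Digraph → ℕ
nDarts G = nE G + nE G

count : ∀ {A : Set} → (A → Bool) → List A → ℕ
count p xs = length (filter (λ a → T? (p a)) xs)
  where
  open import Data.Bool.Properties using (T?)

key : ∀ {G} → Dart G → ℕ
key (e , true)  = toℕ e + toℕ e
key (e , false) = suc (toℕ e + toℕ e)

-- Plane graph data: rotation σ (the cyclic order of darts around each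
-- vertex) together with a designated dart on the outer (unbounded) face.
record PlaneMap (G : Digraph) : Set where
  field
    σ      : Dart G → Dart G
    σ⁻¹    : Dart G → Dart G
    σσ⁻¹   : ∀ d → σ (σ⁻¹ d) ≡ d
    σ⁻¹σ   : ∀ d → σ⁻¹ (σ d) ≡ d
    σ-vert : ∀ d → dvert G (σ d) ≡ dvert G d
    σ-cyc  : ∀ d d′ → dvert G d ≡ dvert G d′ → ∃[ k ] iter k σ d ≡ d′
    outer  : Dart G

  -- face permutation; faces are the orbits of φ
  φ : Dart G → Dart G
  φ d = σ (α {G} d)

  sameFaceᵇ : Dart G → Dart G → Bool
  sameFaceᵇ d d′ = anyᵇ (λ k → does (_≟D_ {G} (iter k φ d) d′)) (upTo (suc (nDarts G)))

  faceRepᵇ : Dart G → Bool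
  faceRepᵇ d = allᵇ (λ k → key {G} d ≤ᵇ key {G} (iter k φ d)) (upTo (suc (nDarts G)))

  nFaces : ℕ
  nFaces = count faceRepᵇ (allDarts G)

  Bounded : Dart G → Set
  Bounded d = T (not (sameFaceᵇ outer d))

  OnOuter : Vtx G → Set
  OnOuter x = ∃[ k ] dvert G (iter k φ outer) ≡ x

  OrientedTriangle : Dart G → Set
  OrientedTriangle d =
    iter 3 φ d ≡ d × φ d ≢ d ×
    proj₂ (φ d) ≡ proj₂ d × proj₂ (φ (φ d)) ≡ proj₂ d

open PlaneMap public

degree : (G : Digraph) → Vtx G → ℕ
degree G x = count (λ d → does (dvert G d ≟F x)) (allDarts G)

SimpleGraph : Digraph → Set
SimpleGraph G =
  (∀ e → src G e ≢ tgt G e) ×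
  (∀ e f → ((src G e ≡ src G f × tgt G e ≡ tgt G f) ⊎
            (src G e ≡ tgt G f × tgt G e ≡ src G f)) → e ≡ f)

-- Planar embedding (genus 0): connected map with Euler characteristic 2.
IsPlane : (G : Digraph) → PlaneMap G → Set
IsPlane G M = Connected G × SimpleGraph G × (nV G + nFaces M ≡ nE G + 2)

IsCAT0Planar : (G : Digraph) → PlaneMap G → Set
IsCAT0Planar G M =
  1 ≤ nV G ×
  IsPlane G M ×
  (∀ d → Bounded M d → OrientedTriangle M d) ×
  (∀ x → ¬ OnOuter M x → 6 ≤ degree G x) ×
  (∀ x → ∃[ d ] (dvert G d ≡ x × Bounded M d)) ×
  (∀ e → Bounded M (e , true) ⊎ Bounded M (e , false))

minAll : (n : ℕ) → (Fin n → ℕ) → ℕ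
minAll zero          f = 0          -- unused: graphs are nonempty
minAll (suc zero)    f = f Fin.zero
minAll (suc (suc n)) f = f Fin.zero ⊓ minAll (suc n) (λ i → f (Fin.suc i))

πI : (G : Digraph) (δ : Vtx G → Vtx G → ℕ) {n : ℕ} (z : Fin n → Vtx G)
     (i j k : Fin n) → ℚ
πI G δ z i j k =
  ℚ.- ((+ minAll (nV G) (λ x → δ x (z i) + δ x (z j) + δ x (z k))) ℚ./ 3)

-- Cyclic intervals [p,q] = {p, p+1, ..., q} (indices mod n)

InCyc : ∀ {n} → Fin n → Fin n → Fin n → Set
InCyc p q i =
  (toℕ p ≤ toℕ q × toℕ p ≤ toℕ i × toℕ i ≤ toℕ q) ⊎
  (toℕ q < toℕ p × (toℕ p ≤ toℕ i ⊎ toℕ i ≤ toℕ q))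

inCyc? : ∀ {n} (p q i : Fin n) → Dec (InCyc p q i)
inCyc? p q i =
  (toℕ p ℕ.≤? toℕ q ×-dec (toℕ p ℕ.≤? toℕ i ×-dec toℕ i ℕ.≤? toℕ q)) ⊎-dec
  (toℕ q ℕ.<? toℕ p ×-dec (toℕ p ℕ.≤? toℕ i ⊎-dec toℕ i ℕ.≤? toℕ q))

ProperCyc : ∀ {n} → Fin n → Fin n → Set
ProperCyc {n} p q = ∃[ i ] ¬ InCyc {n} p q i

-- Wedge: identify v′ ∈ V(G′) with v″ ∈ V(G″).
-- Vertices: Fin (nV G′ + pred (nV G″)); V(G′) embeds as the first block,
-- V(G″) ∖ {v″} as the second block, v″ ↦ v′.

ι″-aux : (a : ℕ) (v′ : Fin a) (b : ℕ) → Fin b → Fin b → Fin (a + ℕ.pred b)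
ι″-aux a v′ (suc m) v″ w with w ≟F v″
... | yes _ = v′ ↑ˡ m
... | no p  = a ↑ʳ punchOut {i = v″} {j = w} (λ eq → p (sym eq))

wedge : (G′ G″ : Digraph) → Vtx G′ → Vtx G″ → Digraph
wedge G′ G″ v′ v″ = record
  { nV  = nV G′ + ℕ.pred (nV G″)
  ; nE  = nE G′ + nE G″
  ; src = λ e → [ (λ e′ → ι′ (src G′ e′)) , (λ e″ → ι″ (src G″ e″)) ] (splitAt (nE G′) e)
  ; tgt = λ e → [ (λ e′ → ι′ (tgt G′ e′)) , (λ e″ → ι″ (tgt G″ e″)) ] (splitAt (nE G′) e)
  }
  where
  ι′ : Vtx G′ → Fin (nV G′ + ℕ.pred (nV G″))
  ι′ x = x ↑ˡ ℕ.pred (nV G″)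
  ι″ : Vtx G″ → Fin (nV G′ + ℕ.pred (nV G″))
  ι″ = ι″-aux (nV G′) v′ (nV G″) v″

wedgeι′ : (G′ G″ : Digraph) (v′ : Vtx G′) (v″ : Vtx G″) → Vtx G′ → Vtx (wedge G′ G″ v′ v″)
wedgeι′ G′ G″ v′ v″ x = x ↑ˡ ℕ.pred (nV G″)

wedgeι″ : (G′ G″ : Digraph) (v′ : Vtx G′) (v″ : Vtx G″) → Vtx G″ → Vtx (wedge G′ G″ v′ v″)
wedgeι″ G′ G″ v′ v″ = ι″-aux (nV G′) v′ (nV G″) v″

-- labels of the glued graph: z_i = z′_i for i ∈ [r,s], otherwise z″_i
-- (for i ∈ [p,q] ∩ [r,s] both are the glued vertex).
wedgeLabels : (G′ G″ : Digraph) (v′ : Vtx G′) (v″ : Vtx G″) {n : ℕ}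
              (z′ : Fin n → Vtx G′) (z″ : Fin n → Vtx G″) (r s : Fin n) →
              Fin n → Vtx (wedge G′ G″ v′ v″)
wedgeLabels G′ G″ v′ v″ z′ z″ r s i =
  if does (inCyc? r s i) then wedgeι′ G′ G″ v′ v″ (z′ i) else wedgeι″ G′ G″ v′ v″ (z″ i)

module Submission where

-- The wedge Q has retractions r′ : Q → Q′ and r″ : Q → Q″, each collapsing the other side
-- onto the cut vertex, and every edge of Q is carried by exactly one of them. Walk costs
-- therefore split, and the directed distance of Q is δ(x,y) = δ′(r′x,r′y) + δ″(r″x,r″y).
-- The labels retract to z′ and z″, so the objective minimised in π_{ijk}(Q) is the sum of
-- those of Q′ and Q″, and its minimum is the sum of the two minima as soon as one vertex of
-- Q minimises both. Two of i, j, k lie on the same side, say in [r,s]; their labels in Q″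
-- sit at v″, which then minimises the Q″ objective since a reversed walk costs at most
-- twice as much. Hence any vertex of Q′ minimising the Q′ objective does the job.

open import Defs
open import Data.Nat using (ℕ; zero; suc; _+_; _≤_; _<_; pred; z≤n)
open import Data.Nat.Properties as ℕ
  using (≤-refl; ≤-trans; +-mono-≤; +-monoˡ-≤; +-identityʳ; +-comm; ≤-antisym; m≤n+m; n≤0⇒n≡0)
open import Algebra.Properties.CommutativeSemigroup ℕ.+-commutativeSemigroup using (interchange)
open import Data.Nat.Tactic.RingSolver using (solve-∀)
open import Data.Fin as Fin using (Fin; toℕ; _↑ˡ_; _↑ʳ_; splitAt; join; punchOut; punchIn)
open import Data.Fin.Properties
  using (splitAt-↑ˡ; splitAt-↑ʳ; join-splitAt; punchIn-punchOut; punchOut-punchIn; punchOut-cong; punchInᵢ≢i)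
  renaming (_≟_ to _≟F_)
import Data.Integer as ℤ
open import Data.Integer.Properties using (pos-+)
import Data.Integer.Tactic.RingSolver as ℤ-Solver
open import Data.Rational as ℚ using (ℚ)
open import Data.Rational.Properties using (toℚᵘ-injective; toℚᵘ-homo-+; toℚᵘ-homo‿-; toℚᵘ-fromℚᵘ)
open import Data.Rational.Unnormalised as ℚᵘ using (mkℚᵘ; *≡*)
open import Data.Rational.Unnormalised.Properties using (≃-trans; -‿cong; +-cong; module ≃-Reasoning)
open import Data.Product using (Σ; ∃; ∃-syntax; _×_; _,_; proj₁; proj₂)
open import Data.Sum using (_⊎_; inj₁; inj₂; [_,_])
open import Data.Empty using (⊥-elim)
open import Function using (_∘_; id; const)
open import Data.Bool using (if_then_else_)
open import Relation.Nullary using (¬_; Dec; yes; no; does)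
open import Relation.Unary using (Pred; Decidable; ∁)
open import Relation.Binary.PropositionalEquality hiding ([_])

module _ {G : Digraph} where

  infixr 5 _++_
  _++_ : ∀ {x y z} → Walk G x y → Walk G y z → Walk G x z
  []      ++ v = v
  fwd e w ++ v = fwd e (w ++ v)
  bwd e w ++ v = bwd e (w ++ v)

  cost-++ : ∀ {x y z} (w : Walk G x y) (v : Walk G y z) → cost (w ++ v) ≡ cost w + cost v
  cost-++ []        v = refl
  cost-++ (fwd e w) v = cong (1 +_) (cost-++ w v)
  cost-++ (bwd e w) v = cong (2 +_) (cost-++ w v)

  reverse : ∀ {x y} → Walk G x y → Walk G y x
  reverse []        = []
  reverse (fwd e w) = reverse w ++ bwd e []
  reverse (bwd e w) = reverse w ++ fwd e []

  cost-reverse : ∀ {x y} (w : Walk G x y) → cost (reverse w) ≤ cost w + cost w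
  cost-reverse [] = z≤n
  cost-reverse (fwd e w) = begin
    cost (reverse w ++ bwd e [])  ≡⟨ cost-++ (reverse w) (bwd e []) ⟩
    cost (reverse w) + 2          ≤⟨ +-monoˡ-≤ 2 (cost-reverse w) ⟩
    cost w + cost w + 2           ≡⟨ doubled-suc (cost w) ⟩
    suc (cost w) + suc (cost w)   ∎
    where
    open ℕ.≤-Reasoning
    doubled-suc : ∀ m → m + m + 2 ≡ suc m + suc m
    doubled-suc = solve-∀
  cost-reverse (bwd e w) = begin
    cost (reverse w ++ fwd e [])          ≡⟨ cost-++ (reverse w) (fwd e []) ⟩
    cost (reverse w) + 1                  ≤⟨ +-monoˡ-≤ 1 (cost-reverse w) ⟩
    cost w + cost w + 1                   ≤⟨ m≤n+m _ 3 ⟩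
    3 + (cost w + cost w + 1)             ≡⟨ doubled-2+ (cost w) ⟩
    (2 + cost w) + (2 + cost w)           ∎
    where
    open ℕ.≤-Reasoning
    doubled-2+ : ∀ m → 3 + (m + m + 1) ≡ (2 + m) + (2 + m)
    doubled-2+ = solve-∀

  cast : ∀ {x x′ y y′} → x ≡ x′ → y ≡ y′ → Walk G x y → Walk G x′ y′
  cast refl refl w = w

  cost-cast : ∀ {x x′ y y′} (p : x ≡ x′) (q : y ≡ y′) (w : Walk G x y) → cost (cast p q w) ≡ cost w
  cost-cast refl refl w = refl

  still : ∀ {x y} → x ≡ y → Walk G x y
  still refl = []

  cost-still : ∀ {x y} (p : x ≡ y) → cost (still p) ≡ 0
  cost-still refl = refl

module DirDist {G : Digraph} {d : Vtx G → Vtx G → ℕ} (D : IsDirDist G d) where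

  shortest : ∀ x y → Walk G x y
  shortest x y = proj₁ (proj₁ (D x y))

  cost-shortest : ∀ x y → cost (shortest x y) ≡ d x y
  cost-shortest x y = proj₂ (proj₁ (D x y))

  dist-≤-cost : ∀ {x y} (w : Walk G x y) → d x y ≤ cost w
  dist-≤-cost = proj₂ (D _ _)

  dist-self : ∀ x → d x x ≡ 0
  dist-self x = n≤0⇒n≡0 (dist-≤-cost [])

  dist-triangle : ∀ x y z → d x z ≤ d x y + d y z
  dist-triangle x y z = begin
    d x z                                   ≤⟨ dist-≤-cost (shortest x y ++ shortest y z) ⟩
    cost (shortest x y ++ shortest y z)     ≡⟨ cost-++ (shortest x y) (shortest y z) ⟩
    cost (shortest x y) + cost (shortest y z) ≡⟨ cong₂ _+_ (cost-shortest x y) (cost-shortest y z) ⟩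
    d x y + d y z                           ∎
    where open ℕ.≤-Reasoning

  dist-reverse : ∀ x y → d y x ≤ d x y + d x y
  dist-reverse x y = begin
    d y x                                       ≤⟨ dist-≤-cost (reverse (shortest x y)) ⟩
    cost (reverse (shortest x y))               ≤⟨ cost-reverse (shortest x y) ⟩
    cost (shortest x y) + cost (shortest x y)   ≡⟨ cong₂ _+_ (cost-shortest x y) (cost-shortest x y) ⟩
    d x y + d x y                               ∎
    where open ℕ.≤-Reasoning

  dist-≤-return : ∀ v y c → d v c ≤ (d y v + d y v) + d y c
  dist-≤-return v y c = ≤-trans (dist-triangle v y c) (+-monoˡ-≤ (d y c) (dist-reverse y v))

record EdgeAlong (G H : Digraph) (f : Vtx G → Vtx H) (e : Fin (nE G)) : Set where
  constructor along
  field
    image     : Fin (nE H)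
    src-image : f (src G e) ≡ src H image
    tgt-image : f (tgt G e) ≡ tgt H image

Collapses : (G : Digraph) {A : Set} → (Vtx G → A) → Fin (nE G) → Set
Collapses G f e = f (src G e) ≡ f (tgt G e)

IsHomomorphism : (G H : Digraph) → (Vtx G → Vtx H) → Set
IsHomomorphism G H f = ∀ e → EdgeAlong G H f e

Splits : (G H₁ H₂ : Digraph) → (Vtx G → Vtx H₁) → (Vtx G → Vtx H₂) → Set
Splits G H₁ H₂ f₁ f₂ =
  ∀ e → (EdgeAlong G H₁ f₁ e × Collapses G f₂ e) ⊎ (Collapses G f₁ e × EdgeAlong G H₂ f₂ e)

module _ {G H : Digraph} {f : Vtx G → Vtx H} {e : Fin (nE G)} where

  forwardImage : EdgeAlong G H f e → Walk H (f (src G e)) (f (tgt G e))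
  forwardImage (along e′ s t) = cast (sym s) (sym t) (fwd e′ [])

  cost-forwardImage : ∀ a → cost (forwardImage a) ≡ 1
  cost-forwardImage (along e′ s t) = cost-cast {G = H} (sym s) (sym t) (fwd e′ [])

  backwardImage : EdgeAlong G H f e → Walk H (f (tgt G e)) (f (src G e))
  backwardImage (along e′ s t) = cast (sym t) (sym s) (bwd e′ [])

  cost-backwardImage : ∀ a → cost (backwardImage a) ≡ 2
  cost-backwardImage (along e′ s t) = cost-cast {G = H} (sym t) (sym s) (bwd e′ [])

module Projection {G H₁ H₂ : Digraph} {f₁ : Vtx G → Vtx H₁} {f₂ : Vtx G → Vtx H₂}
                  (split : Splits G H₁ H₂ f₁ f₂) where

  Projections : Vtx G → Vtx G → ℕ → Set
  Projections x y c =
    Σ (Walk H₁ (f₁ x) (f₁ y)) λ u₁ → Σ (Walk H₂ (f₂ x) (f₂ y)) λ u₂ → cost u₁ + cost u₂ ≡ c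

  _⊕_ : ∀ {x y z a b} → Projections x y a → Projections y z b → Projections x z (a + b)
  (u₁ , u₂ , cu) ⊕ (v₁ , v₂ , cv) = u₁ ++ v₁ , u₂ ++ v₂ , (begin
    cost (u₁ ++ v₁) + cost (u₂ ++ v₂)         ≡⟨ cong₂ _+_ (cost-++ u₁ v₁) (cost-++ u₂ v₂) ⟩
    (cost u₁ + cost v₁) + (cost u₂ + cost v₂) ≡⟨ interchange (cost u₁) (cost v₁) (cost u₂) (cost v₂) ⟩
    (cost u₁ + cost u₂) + (cost v₁ + cost v₂) ≡⟨ cong₂ _+_ cu cv ⟩
    _                                         ∎)
    where open ≡-Reasoning

  forwardStep : ∀ e → Projections (src G e) (tgt G e) 1
  forwardStep e with split e
  ... | inj₁ (a , c) = forwardImage a , still c , cong₂ _+_ (cost-forwardImage a) (cost-still c)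
  ... | inj₂ (c , a) = still c , forwardImage a , cong₂ _+_ (cost-still c) (cost-forwardImage a)

  backwardStep : ∀ e → Projections (tgt G e) (src G e) 2
  backwardStep e with split e
  ... | inj₁ (a , c) =
    backwardImage a , still (sym c) , cong₂ _+_ (cost-backwardImage a) (cost-still (sym c))
  ... | inj₂ (c , a) =
    still (sym c) , backwardImage a , cong₂ _+_ (cost-still (sym c)) (cost-backwardImage a)

  project : ∀ {x y} (w : Walk G x y) → Projections x y (cost w)
  project []        = [] , [] , refl
  project (fwd e w) = forwardStep e ⊕ project w
  project (bwd e w) = backwardStep e ⊕ project w

module _ {G H₁ H₂ : Digraph} {d : Vtx G → Vtx G → ℕ} {d₁ : Vtx H₁ → Vtx H₁ → ℕ}
         {d₂ : Vtx H₂ → Vtx H₂ → ℕ} (D : IsDirDist G d) (D₁ : IsDirDist H₁ d₁) (D₂ : IsDirDist H₂ d₂) where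
  open DirDist

  dist-split : ∀ {f₁ f₂} → Splits G H₁ H₂ f₁ f₂ →
               ∀ x y → d₁ (f₁ x) (f₁ y) + d₂ (f₂ x) (f₂ y) ≤ d x y
  dist-split {f₁} {f₂} split x y =
    let (u₁ , u₂ , c) = Projection.project split (shortest D x y) in begin
      d₁ (f₁ x) (f₁ y) + d₂ (f₂ x) (f₂ y)  ≤⟨ +-mono-≤ (dist-≤-cost D₁ u₁) (dist-≤-cost D₂ u₂) ⟩
      cost u₁ + cost u₂                     ≡⟨ c ⟩
      cost (shortest D x y)                 ≡⟨ cost-shortest D x y ⟩
      d x y                                 ∎
    where open ℕ.≤-Reasoning

-- A homomorphism paired with a constant map splits.
dist-homomorphism : ∀ {G H : Digraph} {d : Vtx G → Vtx G → ℕ} {d′ : Vtx H → Vtx H → ℕ} {f} →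
                    IsDirDist G d → IsDirDist H d′ → IsHomomorphism G H f →
                    ∀ x y → d′ (f x) (f y) ≤ d x y
dist-homomorphism {d′ = d′} {f} D D′ hom x y = begin
  d′ (f x) (f y)                    ≡⟨ sym (+-identityʳ _) ⟩
  d′ (f x) (f y) + 0                ≡⟨ cong (d′ (f x) (f y) +_) (sym (DirDist.dist-self D′ (f x))) ⟩
  d′ (f x) (f y) + d′ (f x) (f x)   ≤⟨ dist-split D D′ D′ {f₂ = λ _ → f x} (λ e → inj₁ (hom e , refl)) x y ⟩
  _                                 ∎
  where open ℕ.≤-Reasoning

IsArgmin : {A : Set} → (A → ℕ) → A → Set
IsArgmin f x = ∀ y → f x ≤ f y

minAll-≤ : ∀ n f (x : Fin n) → minAll n f ≤ f x
minAll-≤ (suc zero)    f Fin.zero    = ≤-refl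
minAll-≤ (suc (suc n)) f Fin.zero    = ℕ.m⊓n≤m _ _
minAll-≤ (suc (suc n)) f (Fin.suc x) = ≤-trans (ℕ.m⊓n≤n _ _) (minAll-≤ (suc n) (f ∘ Fin.suc) x)

minAll-greatest : ∀ n f {c} → Fin n → (∀ x → c ≤ f x) → c ≤ minAll n f
minAll-greatest (suc zero)    f _ h = h Fin.zero
minAll-greatest (suc (suc n)) f _ h =
  ℕ.⊓-glb (h Fin.zero) (minAll-greatest (suc n) (f ∘ Fin.suc) Fin.zero (h ∘ Fin.suc))

minAll-attained : ∀ n f → Fin n → ∃[ x ] minAll n f ≡ f x
minAll-attained (suc zero)    f _ = Fin.zero , refl
minAll-attained (suc (suc n)) f _
  with ℕ.⊓-sel (f Fin.zero) (minAll (suc n) (f ∘ Fin.suc)) | minAll-attained (suc n) (f ∘ Fin.suc) Fin.zero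
... | inj₁ eq | _        = Fin.zero , eq
... | inj₂ eq | x , eq′  = Fin.suc x , trans eq eq′

argmin : ∀ n f → Fin n → ∃ (IsArgmin f)
argmin n f x₀ = let (x , eq) = minAll-attained n f x₀ in x , λ y → subst (_≤ f y) eq (minAll-≤ n f y)

minAll-separable : ∀ {m a b} (F : Fin m → ℕ) (F′ : Fin a → ℕ) (F″ : Fin b → ℕ)
                   (f′ : Fin m → Fin a) (f″ : Fin m → Fin b) →
                   (∀ x → F x ≡ F′ (f′ x) + F″ (f″ x)) →
                   ∀ x₀ → IsArgmin F′ (f′ x₀) → IsArgmin F″ (f″ x₀) →
                   minAll m F ≡ minAll a F′ + minAll b F″
minAll-separable {m} {a} {b} F F′ F″ f′ f″ F≡ x₀ min′ min″ = ≤-antisym upper lower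
  where
  open ℕ.≤-Reasoning
  upper : minAll m F ≤ minAll a F′ + minAll b F″
  upper = begin
    minAll m F                    ≤⟨ minAll-≤ m F x₀ ⟩
    F x₀                          ≡⟨ F≡ x₀ ⟩
    F′ (f′ x₀) + F″ (f″ x₀)       ≤⟨ +-mono-≤ (minAll-greatest a F′ (f′ x₀) min′)
                                              (minAll-greatest b F″ (f″ x₀) min″) ⟩
    minAll a F′ + minAll b F″     ∎
  lower : minAll a F′ + minAll b F″ ≤ minAll m F
  lower = minAll-greatest m F x₀ λ x → begin
    minAll a F′ + minAll b F″     ≤⟨ +-mono-≤ (minAll-≤ a F′ (f′ x)) (minAll-≤ b F″ (f″ x)) ⟩
    F′ (f′ x) + F″ (f″ x)         ≡˘⟨ F≡ x ⟩
    F x                           ∎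

data AtLeastTwo {A : Set} (P : Pred A _) (a b c : A) : Set where
  ab : P a → P b → AtLeastTwo P a b c
  ac : P a → P c → AtLeastTwo P a b c
  bc : P b → P c → AtLeastTwo P a b c

atLeastTwo-map : ∀ {A B : Set} {P : Pred A _} {R : Pred B _} (f : A → B) →
                 (∀ {x} → P x → R (f x)) → ∀ {a b c} → AtLeastTwo P a b c → AtLeastTwo R (f a) (f b) (f c)
atLeastTwo-map f h (ab pa pb) = ab (h pa) (h pb)
atLeastTwo-map f h (ac pa pc) = ac (h pa) (h pc)
atLeastTwo-map f h (bc pb pc) = bc (h pb) (h pc)

atLeastTwo-or-∁ : ∀ {A : Set} {P : Pred A _} → Decidable P → ∀ a b c →
                  AtLeastTwo P a b c ⊎ AtLeastTwo (∁ P) a b c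
atLeastTwo-or-∁ P? a b c with P? a | P? b | P? c
... | yes pa | yes pb | _      = inj₁ (ab pa pb)
... | yes pa | no ¬pb | yes pc = inj₁ (ac pa pc)
... | no ¬pa | yes pb | yes pc = inj₁ (bc pb pc)
... | yes pa | no ¬pb | no ¬pc = inj₂ (bc ¬pb ¬pc)
... | no ¬pa | yes pb | no ¬pc = inj₂ (ac ¬pa ¬pc)
... | no ¬pa | no ¬pb | _      = inj₂ (ab ¬pa ¬pb)

module _ {G : Digraph} {d : Vtx G → Vtx G → ℕ} (D : IsDirDist G d) where
  open DirDist D

  dist-sum-argmin : ∀ {v a b c} → AtLeastTwo (_≡ v) a b c → IsArgmin (λ y → d y a + d y b + d y c) v
  dist-sum-argmin {v} {c = c} (ab refl refl) y rewrite dist-self v = dist-≤-return v y c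
  dist-sum-argmin {v} {b = b} (ac refl refl) y rewrite dist-self v = begin
    d v b + 0                 ≡⟨ +-identityʳ (d v b) ⟩
    d v b                     ≤⟨ dist-≤-return v y b ⟩
    (d y v + d y v) + d y b   ≡⟨ rotate (d y v) (d y v) (d y b) ⟩
    d y v + d y b + d y v     ∎
    where
    open ℕ.≤-Reasoning
    rotate : ∀ p q r → (p + q) + r ≡ p + r + q
    rotate = solve-∀
  dist-sum-argmin {v} {a} (bc refl refl) y rewrite dist-self v = begin
    d v a + 0 + 0             ≡⟨ trans (+-identityʳ _) (+-identityʳ (d v a)) ⟩
    d v a                     ≤⟨ dist-≤-return v y a ⟩
    (d y v + d y v) + d y a   ≡⟨ rotate (d y v) (d y v) (d y a) ⟩
    d y a + d y v + d y v     ∎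
    where
    open ℕ.≤-Reasoning
    rotate : ∀ p q r → (p + q) + r ≡ r + p + q
    rotate = solve-∀

negThird : ℕ → ℚ
negThird m = ℚ.- (ℤ.+ m ℚ./ 3)

toℚᵘ-negThird : ∀ m → ℚ.toℚᵘ (negThird m) ℚᵘ.≃ ℚᵘ.- mkℚᵘ (ℤ.+ m) 2
toℚᵘ-negThird m = ≃-trans (toℚᵘ-homo‿- (ℤ.+ m ℚ./ 3)) (-‿cong (toℚᵘ-fromℚᵘ (mkℚᵘ (ℤ.+ m) 2)))

negThird-+ : ∀ a b → negThird (a + b) ≡ negThird a ℚ.+ negThird b
negThird-+ a b = toℚᵘ-injective (begin
  ℚ.toℚᵘ (negThird (a + b))                              ≈⟨ toℚᵘ-negThird (a + b) ⟩
  ℚᵘ.- mkℚᵘ (ℤ.+ (a + b)) 2                              ≈⟨ *≡* cross-multiplied ⟩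
  ℚᵘ.- mkℚᵘ (ℤ.+ a) 2 ℚᵘ.+ ℚᵘ.- mkℚᵘ (ℤ.+ b) 2           ≈˘⟨ +-cong (toℚᵘ-negThird a) (toℚᵘ-negThird b) ⟩
  ℚ.toℚᵘ (negThird a) ℚᵘ.+ ℚ.toℚᵘ (negThird b)           ≈˘⟨ toℚᵘ-homo-+ (negThird a) (negThird b) ⟩
  ℚ.toℚᵘ (negThird a ℚ.+ negThird b)                     ∎)
  where
  open ≃-Reasoning
  thirds : ∀ x y → (ℤ.- (x ℤ.+ y)) ℤ.* ℤ.+ 9 ≡ ((ℤ.- x) ℤ.* ℤ.+ 3 ℤ.+ (ℤ.- y) ℤ.* ℤ.+ 3) ℤ.* ℤ.+ 3
  thirds = ℤ-Solver.solve-∀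
  cross-multiplied : (ℤ.- ℤ.+ (a + b)) ℤ.* ℤ.+ 9 ≡ ((ℤ.- ℤ.+ a) ℤ.* ℤ.+ 3 ℤ.+ (ℤ.- ℤ.+ b) ℤ.* ℤ.+ 3) ℤ.* ℤ.+ 3
  cross-multiplied = trans (cong (λ t → (ℤ.- t) ℤ.* ℤ.+ 9) (pos-+ a b)) (thirds (ℤ.+ a) (ℤ.+ b))

if-does-cases : ∀ {P A : Set} (P? : Dec P) (x y : A) →
                (P × (if does P? then x else y) ≡ x) ⊎ (¬ P × (if does P? then x else y) ≡ y)
if-does-cases (yes p) x y = inj₁ (p , refl)
if-does-cases (no ¬p) x y = inj₂ (¬p , refl)

↑-cover : ∀ m {n} (i : Fin (m + n)) → (∃[ a ] i ≡ a ↑ˡ n) ⊎ (∃[ b ] i ≡ m ↑ʳ b)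
↑-cover m {n} i with splitAt m i in eq
... | inj₁ a = inj₁ (a , trans (sym (join-splitAt m n i)) (cong (join m n) eq))
... | inj₂ b = inj₂ (b , trans (sym (join-splitAt m n i)) (cong (join m n) eq))

-- Vertices of the wedge, with a = nV Q′. The lemmas quantify over b = nV Q″ because ι″-aux
-- only computes once b is a successor.
module GluedVertices (a : ℕ) (v′ : Fin a) where

  retract′ : ∀ b → Fin (a + pred b) → Fin a
  retract′ b x = [ id , const v′ ] (splitAt a x)

  retract″ : ∀ b → Fin b → Fin (a + pred b) → Fin b
  retract″ (suc m) v″ x = [ const v″ , punchIn v″ ] (splitAt a x)

  retract′-↑ˡ : ∀ b x → retract′ b (x ↑ˡ pred b) ≡ x
  retract′-↑ˡ b x rewrite splitAt-↑ˡ a x (pred b) = refl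

  retract″-↑ˡ : ∀ b v″ x → retract″ b v″ (x ↑ˡ pred b) ≡ v″
  retract″-↑ˡ (suc m) v″ x rewrite splitAt-↑ˡ a x m = refl

  retract′-ι″ : ∀ b v″ y → retract′ b (ι″-aux a v′ b v″ y) ≡ v′
  retract′-ι″ (suc m) v″ y with y ≟F v″
  ... | yes _  rewrite splitAt-↑ˡ a v′ m = refl
  ... | no y≢v″ rewrite splitAt-↑ʳ a m (punchOut (y≢v″ ∘ sym)) = refl

  retract″-ι″ : ∀ b v″ y → retract″ b v″ (ι″-aux a v′ b v″ y) ≡ y
  retract″-ι″ (suc m) v″ y with y ≟F v″
  ... | yes y≡v″ rewrite splitAt-↑ˡ a v′ m = sym y≡v″
  ... | no y≢v″  rewrite splitAt-↑ʳ a m (punchOut (y≢v″ ∘ sym)) = punchIn-punchOut _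

  ι″-cut : ∀ b v″ → ι″-aux a v′ b v″ v″ ≡ v′ ↑ˡ pred b
  ι″-cut (suc m) v″ with v″ ≟F v″
  ... | yes _     = refl
  ... | no v″≢v″  = ⊥-elim (v″≢v″ refl)

  ι″-punchIn : ∀ m v″ j → ι″-aux a v′ (suc m) v″ (punchIn v″ j) ≡ a ↑ʳ j
  ι″-punchIn m v″ j with punchIn v″ j ≟F v″
  ... | yes eq = ⊥-elim (punchInᵢ≢i v″ j eq)
  ... | no _   = cong (a ↑ʳ_) (trans (punchOut-cong v″ refl) (punchOut-punchIn v″))

  glued-cover : ∀ b v″ x → (∃[ y ] x ≡ y ↑ˡ pred b) ⊎ (∃[ y ] x ≡ ι″-aux a v′ b v″ y)
  glued-cover (suc m) v″ x with ↑-cover a x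
  ... | inj₁ left         = inj₁ left
  ... | inj₂ (j , x≡a↑ʳj) = inj₂ (punchIn v″ j , trans x≡a↑ʳj (sym (ι″-punchIn m v″ j)))

tripleDist : ∀ {V : Set} {n} → (V → V → ℕ) → (Fin n → V) → Fin n → Fin n → Fin n → V → ℕ
tripleDist d z i j k x = d x (z i) + d x (z j) + d x (z k)

module Wedge (Q′ Q″ : Digraph) (v′ : Vtx Q′) (v″ : Vtx Q″) where
  open GluedVertices (nV Q′) v′

  W : Digraph
  W = wedge Q′ Q″ v′ v″

  ι′ : Vtx Q′ → Vtx W
  ι′ = wedgeι′ Q′ Q″ v′ v″

  ι″ : Vtx Q″ → Vtx W
  ι″ = wedgeι″ Q′ Q″ v′ v″

  r′ : Vtx W → Vtx Q′
  r′ = retract′ (nV Q″)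

  r″ : Vtx W → Vtx Q″
  r″ = retract″ (nV Q″) v″

  r′-ι′ : ∀ x → r′ (ι′ x) ≡ x
  r′-ι′ = retract′-↑ˡ (nV Q″)

  r″-ι′ : ∀ x → r″ (ι′ x) ≡ v″
  r″-ι′ = retract″-↑ˡ (nV Q″) v″

  r′-ι″ : ∀ y → r′ (ι″ y) ≡ v′
  r′-ι″ = retract′-ι″ (nV Q″) v″

  r″-ι″ : ∀ y → r″ (ι″ y) ≡ y
  r″-ι″ = retract″-ι″ (nV Q″) v″

  ι″-v″ : ι″ v″ ≡ ι′ v′
  ι″-v″ = ι″-cut (nV Q″) v″

  vertex-cover : ∀ x → (∃[ y ] x ≡ ι′ y) ⊎ (∃[ y ] x ≡ ι″ y)
  vertex-cover = glued-cover (nV Q″) v″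

  src-↑ˡ : ∀ e → src W (e ↑ˡ nE Q″) ≡ ι′ (src Q′ e)
  src-↑ˡ e rewrite splitAt-↑ˡ (nE Q′) e (nE Q″) = refl

  tgt-↑ˡ : ∀ e → tgt W (e ↑ˡ nE Q″) ≡ ι′ (tgt Q′ e)
  tgt-↑ˡ e rewrite splitAt-↑ˡ (nE Q′) e (nE Q″) = refl

  src-↑ʳ : ∀ e → src W (nE Q′ ↑ʳ e) ≡ ι″ (src Q″ e)
  src-↑ʳ e rewrite splitAt-↑ʳ (nE Q′) (nE Q″) e = refl

  tgt-↑ʳ : ∀ e → tgt W (nE Q′ ↑ʳ e) ≡ ι″ (tgt Q″ e)
  tgt-↑ʳ e rewrite splitAt-↑ʳ (nE Q′) (nE Q″) e = refl

  ι′-homomorphism : IsHomomorphism Q′ W ι′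
  ι′-homomorphism e = along (e ↑ˡ nE Q″) (sym (src-↑ˡ e)) (sym (tgt-↑ˡ e))

  ι″-homomorphism : IsHomomorphism Q″ W ι″
  ι″-homomorphism e = along (nE Q′ ↑ʳ e) (sym (src-↑ʳ e)) (sym (tgt-↑ʳ e))

  retractions-split : Splits W Q′ Q″ r′ r″
  retractions-split e with ↑-cover (nE Q′) e
  ... | inj₁ (e′ , refl) =
    inj₁ ( along e′ (r′-at (src-↑ˡ e′)) (r′-at (tgt-↑ˡ e′))
         , trans (r″-at (src-↑ˡ e′)) (sym (r″-at (tgt-↑ˡ e′))) )
    where
    r′-at : ∀ {w x} → w ≡ ι′ x → r′ w ≡ x
    r′-at {x = x} w≡ι′x = trans (cong r′ w≡ι′x) (r′-ι′ x)
    r″-at : ∀ {w x} → w ≡ ι′ x → r″ w ≡ v″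
    r″-at {x = x} w≡ι′x = trans (cong r″ w≡ι′x) (r″-ι′ x)
  ... | inj₂ (e″ , refl) =
    inj₂ ( trans (r′-at (src-↑ʳ e″)) (sym (r′-at (tgt-↑ʳ e″)))
         , along e″ (r″-at (src-↑ʳ e″)) (r″-at (tgt-↑ʳ e″)) )
    where
    r′-at : ∀ {w y} → w ≡ ι″ y → r′ w ≡ v′
    r′-at {y = y} w≡ι″y = trans (cong r′ w≡ι″y) (r′-ι″ y)
    r″-at : ∀ {w y} → w ≡ ι″ y → r″ w ≡ y
    r″-at {y = y} w≡ι″y = trans (cong r″ w≡ι″y) (r″-ι″ y)

  module Distances {δ′ : Vtx Q′ → Vtx Q′ → ℕ} {δ″ : Vtx Q″ → Vtx Q″ → ℕ} {δ : Vtx W → Vtx W → ℕ}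
                   (D′ : IsDirDist Q′ δ′) (D″ : IsDirDist Q″ δ″) (D : IsDirDist W δ) where
    open DirDist

    ι′-dist : ∀ x y → δ (ι′ x) (ι′ y) ≤ δ′ x y
    ι′-dist = dist-homomorphism D′ D ι′-homomorphism

    ι″-dist : ∀ x y → δ (ι″ x) (ι″ y) ≤ δ″ x y
    ι″-dist = dist-homomorphism D″ D ι″-homomorphism

    ι′-ι″-dist : ∀ x y → δ (ι′ x) (ι″ y) ≤ δ′ x v′ + δ″ v″ y
    ι′-ι″-dist x y = begin
      δ (ι′ x) (ι″ y)                       ≤⟨ dist-triangle D (ι′ x) (ι″ v″) (ι″ y) ⟩
      δ (ι′ x) (ι″ v″) + δ (ι″ v″) (ι″ y)   ≡⟨ cong (λ m → δ (ι′ x) m + δ (ι″ v″) (ι″ y)) ι″-v″ ⟩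
      δ (ι′ x) (ι′ v′) + δ (ι″ v″) (ι″ y)   ≤⟨ +-mono-≤ (ι′-dist x v′) (ι″-dist v″ y) ⟩
      δ′ x v′ + δ″ v″ y                     ∎
      where open ℕ.≤-Reasoning

    ι″-ι′-dist : ∀ x y → δ (ι″ x) (ι′ y) ≤ δ′ v′ y + δ″ x v″
    ι″-ι′-dist x y = begin
      δ (ι″ x) (ι′ y)                       ≤⟨ dist-triangle D (ι″ x) (ι″ v″) (ι′ y) ⟩
      δ (ι″ x) (ι″ v″) + δ (ι″ v″) (ι′ y)   ≡⟨ cong (λ m → δ (ι″ x) (ι″ v″) + δ m (ι′ y)) ι″-v″ ⟩
      δ (ι″ x) (ι″ v″) + δ (ι′ v′) (ι′ y)   ≤⟨ +-mono-≤ (ι″-dist x v″) (ι′-dist v′ y) ⟩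
      δ″ x v″ + δ′ v′ y                     ≡⟨ +-comm (δ″ x v″) (δ′ v′ y) ⟩
      δ′ v′ y + δ″ x v″                     ∎
      where open ℕ.≤-Reasoning

    wedge-dist-≤ : ∀ x y → δ x y ≤ δ′ (r′ x) (r′ y) + δ″ (r″ x) (r″ y)
    wedge-dist-≤ x y with vertex-cover x | vertex-cover y
    ... | inj₁ (a , refl) | inj₁ (b , refl)
      rewrite r′-ι′ a | r′-ι′ b | r″-ι′ a | r″-ι′ b | dist-self D″ v″ | +-identityʳ (δ′ a b) = ι′-dist a b
    ... | inj₁ (a , refl) | inj₂ (b , refl) rewrite r′-ι′ a | r′-ι″ b | r″-ι′ a | r″-ι″ b = ι′-ι″-dist a b
    ... | inj₂ (a , refl) | inj₁ (b , refl) rewrite r′-ι″ a | r′-ι′ b | r″-ι″ a | r″-ι′ b = ι″-ι′-dist a b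
    ... | inj₂ (a , refl) | inj₂ (b , refl) rewrite r′-ι″ a | r′-ι″ b | r″-ι″ a | r″-ι″ b | dist-self D′ v′ =
      ι″-dist a b

    wedge-dist : ∀ x y → δ x y ≡ δ′ (r′ x) (r′ y) + δ″ (r″ x) (r″ y)
    wedge-dist x y = ≤-antisym (wedge-dist-≤ x y) (dist-split D D′ D″ retractions-split x y)

    module Labelled {n} (z′ : Fin n → Vtx Q′) (z″ : Fin n → Vtx Q″) (r s : Fin n)
                    (inside : ∀ i → InCyc r s i → z″ i ≡ v″) (outside : ∀ i → ¬ InCyc r s i → z′ i ≡ v′) where

      z : Fin n → Vtx W
      z = wedgeLabels Q′ Q″ v′ v″ z′ z″ r s

      label-cases : ∀ i → (InCyc r s i × z i ≡ ι′ (z′ i)) ⊎ (¬ InCyc r s i × z i ≡ ι″ (z″ i))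
      label-cases i = if-does-cases (inCyc? r s i) (ι′ (z′ i)) (ι″ (z″ i))

      r′-z : ∀ i → r′ (z i) ≡ z′ i
      r′-z i with label-cases i
      ... | inj₁ (_   , eq) = trans (cong r′ eq) (r′-ι′ (z′ i))
      ... | inj₂ (out , eq) = trans (cong r′ eq) (trans (r′-ι″ (z″ i)) (sym (outside i out)))

      r″-z : ∀ i → r″ (z i) ≡ z″ i
      r″-z i with label-cases i
      ... | inj₁ (ins , eq) = trans (cong r″ eq) (trans (r″-ι′ (z′ i)) (sym (inside i ins)))
      ... | inj₂ (_   , eq) = trans (cong r″ eq) (r″-ι″ (z″ i))

      dist-to-label : ∀ x i → δ x (z i) ≡ δ′ (r′ x) (z′ i) + δ″ (r″ x) (z″ i)
      dist-to-label x i =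
        trans (wedge-dist x (z i)) (cong₂ _+_ (cong (δ′ (r′ x)) (r′-z i)) (cong (δ″ (r″ x)) (r″-z i)))

      tripleDist-split : ∀ i j k x →
        tripleDist δ z i j k x ≡ tripleDist δ′ z′ i j k (r′ x) + tripleDist δ″ z″ i j k (r″ x)
      tripleDist-split i j k x = begin
        δ x (z i) + δ x (z j) + δ x (z k)
          ≡⟨ cong₂ _+_ (cong₂ _+_ (dist-to-label x i) (dist-to-label x j)) (dist-to-label x k) ⟩
        (d′ i + d″ i) + (d′ j + d″ j) + (d′ k + d″ k)
          ≡⟨ cong (_+ (d′ k + d″ k)) (interchange (d′ i) (d″ i) (d′ j) (d″ j)) ⟩
        (d′ i + d′ j) + (d″ i + d″ j) + (d′ k + d″ k)
          ≡⟨ interchange (d′ i + d′ j) (d″ i + d″ j) (d′ k) (d″ k) ⟩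
        (d′ i + d′ j + d′ k) + (d″ i + d″ j + d″ k)
          ∎
        where
        open ≡-Reasoning
        d′ : Fin n → ℕ
        d′ l = δ′ (r′ x) (z′ l)
        d″ : Fin n → ℕ
        d″ l = δ″ (r″ x) (z″ l)

      minAll-tripleDist : ∀ i j k → minAll (nV W) (tripleDist δ z i j k)
                          ≡ minAll (nV Q′) (tripleDist δ′ z′ i j k) + minAll (nV Q″) (tripleDist δ″ z″ i j k)
      minAll-tripleDist i j k
        with atLeastTwo-or-∁ (inCyc? r s) i j k
           | argmin (nV Q′) (tripleDist δ′ z′ i j k) v′
           | argmin (nV Q″) (tripleDist δ″ z″ i j k) v″
      ... | inj₁ two-inside | x , x-min | _ =
        minAll-separable _ _ _ r′ r″ (tripleDist-split i j k) (ι′ x)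
          (subst (IsArgmin _) (sym (r′-ι′ x)) x-min)
          (subst (IsArgmin _) (sym (r″-ι′ x)) (dist-sum-argmin D″ (atLeastTwo-map z″ (inside _) two-inside)))
      ... | inj₂ two-outside | _ | y , y-min =
        minAll-separable _ _ _ r′ r″ (tripleDist-split i j k) (ι″ y)
          (subst (IsArgmin _) (sym (r′-ι″ y)) (dist-sum-argmin D′ (atLeastTwo-map z′ (outside _) two-outside)))
          (subst (IsArgmin _) (sym (r″-ι″ y)) y-min)

      πI-wedge : ∀ i j k → πI W δ z i j k ≡ πI Q′ δ′ z′ i j k ℚ.+ πI Q″ δ″ z″ i j k
      πI-wedge i j k = trans (cong negThird (minAll-tripleDist i j k)) (negThird-+ m′ m″)
        where
        m′ m″ : ℕ
        m′ = minAll (nV Q′) (tripleDist δ′ z′ i j k)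
        m″ = minAll (nV Q″) (tripleDist δ″ z″ i j k)

proposition12p1 : (n : ℕ) (Q′ Q″ : Digraph) (M′ : PlaneMap Q′) (M″ : PlaneMap Q″) →
    IsCAT0Planar Q′ M′ → IsCAT0Planar Q″ M″ →
    (z′ : Fin n → Vtx Q′) (z″ : Fin n → Vtx Q″) →
    (v′ : Vtx Q′) (v″ : Vtx Q″) (p q r s : Fin n) →
    ProperCyc p q → ProperCyc r s →
    (∀ i → InCyc p q i → z′ i ≡ v′) →
    (∀ i → InCyc r s i → z″ i ≡ v″) →
    (∀ i → InCyc p q i ⊎ InCyc r s i) →
    (δ′ : Vtx Q′ → Vtx Q′ → ℕ) → IsDirDist Q′ δ′ →
    (δ″ : Vtx Q″ → Vtx Q″ → ℕ) → IsDirDist Q″ δ″ →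
    (δ : Vtx (wedge Q′ Q″ v′ v″) → Vtx (wedge Q′ Q″ v′ v″) → ℕ) →
    IsDirDist (wedge Q′ Q″ v′ v″) δ →
    (i j k : Fin n) → toℕ i < toℕ j → toℕ j < toℕ k →
    πI (wedge Q′ Q″ v′ v″) δ (wedgeLabels Q′ Q″ v′ v″ z′ z″ r s) i j k
      ≡ πI Q′ δ′ z′ i j k ℚ.+ πI Q″ δ″ z″ i j k
proposition12p1 n Q′ Q″ _ _ _ _ z′ z″ v′ v″ p q r s _ _ at-v′ at-v″ cover δ′ D′ δ″ D″ δ D i j k _ _ =
  πI-wedge i j k
  where
  outside : ∀ i → ¬ InCyc r s i → z′ i ≡ v′
  outside i ∉rs with cover i
  ... | inj₁ ∈pq = at-v′ i ∈pq
  ... | inj₂ ∈rs = ⊥-elim (∉rs ∈rs)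
  open Wedge.Distances.Labelled Q′ Q″ v′ v″ D′ D″ D z′ z″ r s at-v″ outside
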